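{- Let $\mathbf{L}\in\{\mathbf{K},\mathbf{T},\mathbf{K4},\mathbf{S4}\}$. Then $\mathbf{L}^{Horn}$ and $\mathbf{L}^{Krom}$ are expressively incomparable within the same propositional alphabet, i.e. there is no model-preserving translation from $\mathbf{L}^{Horn}$ to $\mathbf{L}^{Krom}$ and no model-preserving translation from $\mathbf{L}^{Krom}$ to $\mathbf{L}^{Horn}$.
   Context: Fix a countable set $\mathcal P$ of propositional letters. Modal formulas are generated by $\varphi ::= \top \mid p \mid \neg\varphi \mid \varphi\vee\varphi \mid \Diamond\varphi \mid \Box\varphi$; Kripke models $M=(W,R,V)$ with $V:W\to2^{\mathcal P}$ and standard satisfaction. $\mathbf{K},\mathbf{T},\mathbf{K4},\mathbf{S4}$ are interpreted over all, reflexive, transitive, and reflexive-transitive frames respectively. Positive literals: $\lambda ::= \top \mid p \mid \Diamond\lambda \mid \Box\lambda$. A clause is $\Box^s(\neg\lambda_1\vee\dots\vee\neg\lambda_n\vee\lambda_{n+1}\vee\dots\vee\lambda_{n+m})$ ($s,n,m\ge0$); clausal-form formulas are finite conjunctions of clauses (literals count as clauses). $\mathbf{L}^{Horn}$: clausal-form formulas all of whose clauses have $m\le1$; $\mathbf{L}^{Krom}$: all clauses have $n+m\le2$; both interpreted over the frame class of $\mathbf{L}$. A model-preserving translation from $\mathcal L_1$ to $\mathcal L_2$ (same frame class $\mathcal C$) is an effective map $\varphi\mapsto\varphi'$ from $\mathcal L_1$-formulas to $\mathcal L_2$-formulas over the same propositional letters such that for every model $M$ over a frame in $\mathcal C$ and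 every world $w$, $M,w\models\varphi$ iff $M,w\models\varphi'$. -}

module Defs where

open import Data.Nat using (ℕ; zero; suc; _+_; _≤_)
open import Data.Bool using (Bool; true; false; T)
open import Data.List using (List; []; _∷_; length)
open import Data.List.Relation.Unary.All using (All)
open import Data.Product using (Σ; _×_; _,_; proj₁)
open import Data.Sum using (_⊎_)
open import Data.Unit using (⊤)
open import Data.Empty using (⊥)
open import Relation.Nullary using (¬_)
open import Function.Bundles using (_⇔_)

Letter : Set
Letter = ℕ

data Fm : Set where
  top  : Fm
  var  : Letter → Fm
  neg  : Fm → Fm
  _∨_  : Fm → Fm → Fm
  ◇_   : Fm → Fm
  □_   : Fm → Fm

record Model : Set₁ where
  field
    W : Set
    R : W → W → Set
    V : W → Letter → Bool

open Model public

_,_⊨_ : (M : Model) → W M → Fm → Set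
M , w ⊨ top     = ⊤
M , w ⊨ var p   = T (V M w p)
M , w ⊨ neg φ   = ¬ (M , w ⊨ φ)
M , w ⊨ (φ ∨ ψ) = (M , w ⊨ φ) ⊎ (M , w ⊨ ψ)
M , w ⊨ (◇ φ)   = Σ (W M) λ v → R M w v × (M , v ⊨ φ)
M , w ⊨ (□ φ)   = (v : W M) → R M w v → M , v ⊨ φ

data Logic : Set where
  K T' K4 S4 : Logic

Reflexive : {W : Set} → (W → W → Set) → Set
Reflexive {W} R = (w : W) → R w w

Transitive : {W : Set} → (W → W → Set) → Set
Transitive {W} R = (u v w : W) → R u v → R v w → R u w

FrameCond : Logic → (W : Set) → (W → W → Set) → Set
FrameCond K  W R = ⊤
FrameCond T' W R = Reflexive R
FrameCond K4 W R = Transitive R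
FrameCond S4 W R = Reflexive R × Transitive R

InClass : Logic → Model → Set
InClass L M = FrameCond L (W M) (R M)

data PLit : Set where
  ptop : PLit
  pvar : Letter → PLit
  p◇   : PLit → PLit
  p□   : PLit → PLit

litFm : PLit → Fm
litFm ptop     = top
litFm (pvar p) = var p
litFm (p◇ l)   = ◇ litFm l
litFm (p□ l)   = □ litFm l

-- Clause  □^s (¬λ1 ∨ … ∨ ¬λn ∨ λ(n+1) ∨ … ∨ λ(n+m))
record Clause : Set where
  constructor clause
  field
    boxes : ℕ
    negs  : List PLit
    poss  : List PLit

open Clause public

bot : Fm
bot = neg top

⋁ : List Fm → Fm
⋁ []           = bot
⋁ (φ ∷ [])     = φ
⋁ (φ ∷ ψ ∷ φs) = φ ∨ ⋁ (ψ ∷ φs)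

_∧_ : Fm → Fm → Fm
φ ∧ ψ = neg (neg φ ∨ neg ψ)

⋀ : List Fm → Fm
⋀ []           = top
⋀ (φ ∷ [])     = φ
⋀ (φ ∷ ψ ∷ φs) = φ ∧ ⋀ (ψ ∷ φs)

boxN : ℕ → Fm → Fm
boxN zero    φ = φ
boxN (suc s) φ = □ boxN s φ

mapNeg : List PLit → List Fm
mapNeg []       = []
mapNeg (l ∷ ls) = neg (litFm l) ∷ mapNeg ls

mapPos : List PLit → List Fm
mapPos []       = []
mapPos (l ∷ ls) = litFm l ∷ mapPos ls

appendF : List Fm → List Fm → List Fm
appendF []       ys = ys
appendF (x ∷ xs) ys = x ∷ appendF xs ys

clauseFm : Clause → Fm
clauseFm c = boxN (boxes c) (⋁ (appendF (mapNeg (negs c)) (mapPos (poss c))))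

Clausal : Set
Clausal = List Clause

clausalFm : Clausal → Fm
clausalFm cs = ⋀ (Data.List.map clauseFm cs)

IsHornClause : Clause → Set
IsHornClause c = length (poss c) ≤ 1

IsKromClause : Clause → Set
IsKromClause c = length (negs c) + length (poss c) ≤ 2

HornFm : Set
HornFm = Σ Clausal (All IsHornClause)

KromFm : Set
KromFm = Σ Clausal (All IsKromClause)

hornFm : HornFm → Fm
hornFm h = clausalFm (proj₁ h)

kromFm : KromFm → Fm
kromFm k = clausalFm (proj₁ k)

ModelPreserving : (L : Logic) {A B : Set} → (A → Fm) → (B → Fm) → (A → B) → Set₁
ModelPreserving L {A} {B} ⟦_⟧A ⟦_⟧B t =
  (M : Model) → InClass L M → (w : W M) → (φ : A) →
    (M , w ⊨ ⟦ φ ⟧A) ⇔ (M , w ⊨ ⟦ t φ ⟧B)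

HornToKrom : Logic → Set₁
HornToKrom L = Σ (HornFm → KromFm) (ModelPreserving L hornFm kromFm)

KromToHorn : Logic → Set₁
KromToHorn L = Σ (KromFm → HornFm) (ModelPreserving L kromFm hornFm)

-- On a one-point frame whose single world sees itself (a frame of every class considered),
-- a modal formula is true exactly when its propositional reading, with □ and ◇ erased, is
-- true under the valuation of the world; so a model-preserving translation must keep
-- the truth value under every valuation. Horn formulas are preserved by pointwise meets
-- of valuations, Krom formulas by the pointwise majority of three valuations. But
-- p₀ ∧ p₁ → p₂ is not preserved by majority, and p₀ ∨ p₁ is not preserved by meets.
module Submission where

open import Defs
open import Data.Product using (_×_)
open import Relation.Nullary using (¬_)

open import Data.Bool using (Bool; true; false; T; not) renaming (_∨_ to _∨ᵇ_; _∧_ to _∧ᵇ_)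
open import Data.Bool.Properties using (T-∨; T-∧)
open import Data.Bool.ListAction using (any)
open import Data.List using (List; []; _∷_; _++_; map; length)
open import Data.List.Properties using (length-++; length-map)
open import Data.List.Relation.Unary.All as All using (All; []; _∷_; universal)
import Data.List.Relation.Unary.All.Properties as All
open import Data.List.Relation.Unary.Any as Any using (Any; here)
open import Data.List.Relation.Unary.Any.Properties using (++↔; map↔; ∷↔; singleton⁻)
open import Data.Nat using (zero; suc; _≡ᵇ_; _≤_; _+_; s≤s; z≤n)
open import Data.Product using (_,_; proj₁; proj₂)
open import Data.Product.Function.NonDependent.Propositional using (_×-⇔_)
open import Data.Sum using (_⊎_; inj₁; inj₂)
open import Data.Sum.Function.Propositional using (_⊎-⇔_)
open import Data.Unit using (tt) renaming (⊤ to Unit)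
open import Function using (_∘_)
open import Function.Bundles using (_⇔_; mk⇔; Equivalence)
open import Function.Properties.Equivalence using (refl; sym; trans)
open import Function.Properties.Inverse using (↔⇒⇔)
open import Relation.Binary.PropositionalEquality as ≡ using (_≡_; cong; cong₂; subst)

open Equivalence using (to; from)

Valuation : Set
Valuation = Letter → Bool

eval : Valuation → Fm → Bool
eval V top     = true
eval V (var p) = V p
eval V (neg φ) = not (eval V φ)
eval V (φ ∨ ψ) = eval V φ ∨ᵇ eval V ψ
eval V (◇ φ)   = eval V φ
eval V (□ φ)   = eval V φ

T-not : ∀ {b} → T (not b) ⇔ (¬ T b)
T-not {true}  = mk⇔ (λ ()) (λ ¬t → ¬t tt)
T-not {false} = mk⇔ (λ _ ()) (λ _ → tt)

T-not-contra : ∀ {a b} → (T a → T b) → T (not b) → T (not a)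
T-not-contra a⇒b ¬b = from T-not (to T-not ¬b ∘ a⇒b)

T-not-∨-not : ∀ {a b} → T (not (not a ∨ᵇ not b)) ⇔ (T a × T b)
T-not-∨-not {true}  {true}  = mk⇔ (λ _ → tt , tt) (λ _ → tt)
T-not-∨-not {true}  {false} = mk⇔ (λ ()) proj₂
T-not-∨-not {false}         = mk⇔ (λ ()) proj₁

pointModel : Valuation → Model
pointModel V = record { W = Unit ; R = λ _ _ → Unit ; V = λ _ → V }

pointModel-inClass : ∀ L V → InClass L (pointModel V)
pointModel-inClass K  V = tt
pointModel-inClass T' V = λ _ → tt
pointModel-inClass K4 V = λ _ _ _ _ _ → tt
pointModel-inClass S4 V = (λ _ → tt) , (λ _ _ _ _ _ → tt)

pointModel-⊨⇔eval : ∀ V φ → (pointModel V , tt ⊨ φ) ⇔ T (eval V φ)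
pointModel-⊨⇔eval V top     = refl
pointModel-⊨⇔eval V (var p) = refl
pointModel-⊨⇔eval V (neg φ) =
  mk⇔ (λ ¬s → from T-not (¬s ∘ from ih)) (λ t → to T-not t ∘ to ih)
  where ih = pointModel-⊨⇔eval V φ
pointModel-⊨⇔eval V (φ ∨ ψ) =
  trans (pointModel-⊨⇔eval V φ ⊎-⇔ pointModel-⊨⇔eval V ψ) (sym T-∨)
pointModel-⊨⇔eval V (◇ φ) =
  mk⇔ (λ (_ , _ , s) → to ih s) (λ t → tt , tt , from ih t)
  where ih = pointModel-⊨⇔eval V φ
pointModel-⊨⇔eval V (□ φ) =
  mk⇔ (λ s → to ih (s tt tt)) (λ t _ _ → from ih t)
  where ih = pointModel-⊨⇔eval V φ

modelPreserving⇒eval⇔ : ∀ {L A B} (⟦_⟧A : A → Fm) (⟦_⟧B : B → Fm) {t : A → B} →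
  ModelPreserving L ⟦_⟧A ⟦_⟧B t → ∀ V φ → T (eval V ⟦ φ ⟧A) ⇔ T (eval V ⟦ t φ ⟧B)
modelPreserving⇒eval⇔ {L} ⟦_⟧A ⟦_⟧B {t} preserving V φ =
  trans (sym (pointModel-⊨⇔eval V ⟦ φ ⟧A))
    (trans (preserving (pointModel V) (pointModel-inClass L V) tt φ)
           (pointModel-⊨⇔eval V ⟦ t φ ⟧B))

Op₃ : Set
Op₃ = Bool → Bool → Bool → Bool

pointwise : Op₃ → Valuation → Valuation → Valuation → Valuation
pointwise f V₁ V₂ V₃ p = f (V₁ p) (V₂ p) (V₃ p)

PreservedBy : Op₃ → Fm → Set
PreservedBy f φ = ∀ V₁ V₂ V₃ → T (eval V₁ φ) → T (eval V₂ φ) → T (eval V₃ φ) →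
  T (eval (pointwise f V₁ V₂ V₃) φ)

CommutesWith : Op₃ → Fm → Set
CommutesWith f φ = ∀ V₁ V₂ V₃ →
  eval (pointwise f V₁ V₂ V₃) φ ≡ f (eval V₁ φ) (eval V₂ φ) (eval V₃ φ)

preservedBy-reflect : ∀ {L A B} f (⟦_⟧A : A → Fm) (⟦_⟧B : B → Fm) (t : A → B) →
  ModelPreserving L ⟦_⟧A ⟦_⟧B t → ∀ φ → PreservedBy f ⟦ t φ ⟧B → PreservedBy f ⟦ φ ⟧A
preservedBy-reflect f ⟦_⟧A ⟦_⟧B t preserving φ preserved V₁ V₂ V₃ t₁ t₂ t₃ =
  from (e _) (preserved V₁ V₂ V₃ (to (e V₁) t₁) (to (e V₂) t₂) (to (e V₃) t₃))
  where e = λ V → modelPreserving⇒eval⇔ ⟦_⟧A ⟦_⟧B preserving V φ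

literal-commutesWith : ∀ f → f true true true ≡ true → ∀ l → CommutesWith f (litFm l)
literal-commutesWith f f-true ptop     _ _ _ = ≡.sym f-true
literal-commutesWith f f-true (pvar p) _ _ _ = ≡.refl
literal-commutesWith f f-true (p◇ l)        = literal-commutesWith f f-true l
literal-commutesWith f f-true (p□ l)        = literal-commutesWith f f-true l

eval-boxN : ∀ V s φ → eval V (boxN s φ) ≡ eval V φ
eval-boxN V zero    φ = ≡.refl
eval-boxN V (suc s) φ = eval-boxN V s φ

boxN-preservedBy : ∀ f φ s → PreservedBy f φ → PreservedBy f (boxN s φ)
boxN-preservedBy f φ s preserved V₁ V₂ V₃ t₁ t₂ t₃ =
  subst T (≡.sym (eval-boxN _ s φ))
    (preserved V₁ V₂ V₃ (subst T (eval-boxN V₁ s φ) t₁)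
                        (subst T (eval-boxN V₂ s φ) t₂) (subst T (eval-boxN V₃ s φ) t₃))

⋀-preservedBy : ∀ f {φs} → All (PreservedBy f) φs → PreservedBy f (⋀ φs)
⋀-preservedBy f []             _  _  _  _  _  _  = tt
⋀-preservedBy f (p ∷ [])                         = p
⋀-preservedBy f {φ ∷ φs@(_ ∷ _)} (p ∷ ps) V₁ V₂ V₃ t₁ t₂ t₃ =
  from T-not-∨-not
    ( p V₁ V₂ V₃ (proj₁ (split t₁)) (proj₁ (split t₂)) (proj₁ (split t₃))
    , ⋀-preservedBy f ps V₁ V₂ V₃ (proj₂ (split t₁)) (proj₂ (split t₂)) (proj₂ (split t₃)))
  where
  split : ∀ {V} → T (eval V (φ ∧ ⋀ φs)) → T (eval V φ) × T (eval V (⋀ φs))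
  split = to T-not-∨-not

signedDisjunction : List PLit → List PLit → Fm
signedDisjunction ns ps = ⋁ (map (neg ∘ litFm) ns ++ map litFm ps)

disjuncts≡ : ∀ ns ps → appendF (mapNeg ns) (mapPos ps) ≡ map (neg ∘ litFm) ns ++ map litFm ps
disjuncts≡ []       []       = ≡.refl
disjuncts≡ []       (l ∷ ps) = cong (litFm l ∷_) (disjuncts≡ [] ps)
disjuncts≡ (l ∷ ns) ps       = cong (neg (litFm l) ∷_) (disjuncts≡ ns ps)

clause-preservedBy : ∀ f c → PreservedBy f (signedDisjunction (negs c) (poss c)) →
  PreservedBy f (clauseFm c)
clause-preservedBy f (clause s ns ps) preserved =
  boxN-preservedBy f _ s (subst (PreservedBy f ∘ ⋁) (≡.sym (disjuncts≡ ns ps)) preserved)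

clausal-preservedBy : ∀ f cs → All (PreservedBy f ∘ clauseFm) cs → PreservedBy f (clausalFm cs)
clausal-preservedBy f cs preserved = ⋀-preservedBy f (All.map⁺ preserved)

T-eval-⋁ : ∀ V φs → T (eval V (⋁ φs)) ⇔ Any (T ∘ eval V) φs
T-eval-⋁ V []           = mk⇔ (λ ()) (λ ())
T-eval-⋁ V (φ ∷ [])     = mk⇔ here singleton⁻
T-eval-⋁ V (φ ∷ ψ ∷ φs) =
  trans T-∨ (trans (refl ⊎-⇔ T-eval-⋁ V (ψ ∷ φs)) (↔⇒⇔ (∷↔ (T ∘ eval V))))

T-eval-signedDisjunction : ∀ V ns ps → T (eval V (signedDisjunction ns ps)) ⇔
  (Any (T ∘ eval V ∘ neg ∘ litFm) ns ⊎ Any (T ∘ eval V ∘ litFm) ps)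
T-eval-signedDisjunction V ns ps =
  trans (T-eval-⋁ V _) (trans (sym (↔⇒⇔ ++↔)) (sym (↔⇒⇔ map↔) ⊎-⇔ sym (↔⇒⇔ map↔)))

and₃ : Op₃
and₃ a b c = a ∧ᵇ b ∧ᵇ c

T-eval-and₃-literal : ∀ V₁ V₂ V₃ l → T (eval (pointwise and₃ V₁ V₂ V₃) (litFm l)) ⇔
  (T (eval V₁ (litFm l)) × T (eval V₂ (litFm l)) × T (eval V₃ (litFm l)))
T-eval-and₃-literal V₁ V₂ V₃ l rewrite literal-commutesWith and₃ ≡.refl l V₁ V₂ V₃ =
  trans T-∧ (refl ×-⇔ T-∧)

-- A Horn clause is satisfied through a negative literal, which stays satisfied in the
-- meet, or else all three valuations satisfy its unique positive literal.
horn-clause-preservedBy-and₃ : ∀ c → IsHornClause c → PreservedBy and₃ (clauseFm c)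
horn-clause-preservedBy-and₃ c@(clause _ ns ps) horn = clause-preservedBy and₃ c meet
  where
  meet : PreservedBy and₃ (signedDisjunction ns ps)
  meet V₁ V₂ V₃ t₁ t₂ t₃ =
    from (view V∧) (go ps horn (to (view V₁) t₁) (to (view V₂) t₂) (to (view V₃) t₃))
    where
    V∧ = pointwise and₃ V₁ V₂ V₃
    view = λ V → T-eval-signedDisjunction V ns ps
    meet⇔ = T-eval-and₃-literal V₁ V₂ V₃
    Clause⊨ : Valuation → List PLit → Set
    Clause⊨ V qs = Any (T ∘ eval V ∘ neg ∘ litFm) ns ⊎ Any (T ∘ eval V ∘ litFm) qs

    go : ∀ qs → length qs ≤ 1 → Clause⊨ V₁ qs → Clause⊨ V₂ qs → Clause⊨ V₃ qs → Clause⊨ V∧ qs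
    go _ _ (inj₁ n) _ _ = inj₁ (Any.map (λ {l} → T-not-contra (proj₁ ∘ to (meet⇔ l))) n)
    go _ _ _ (inj₁ n) _ = inj₁ (Any.map (λ {l} → T-not-contra (proj₁ ∘ proj₂ ∘ to (meet⇔ l))) n)
    go _ _ _ _ (inj₁ n) = inj₁ (Any.map (λ {l} → T-not-contra (proj₂ ∘ proj₂ ∘ to (meet⇔ l))) n)
    go (l ∷ []) _ (inj₂ a) (inj₂ b) (inj₂ c) =
      inj₂ (here (from (meet⇔ l) (singleton⁻ a , singleton⁻ b , singleton⁻ c)))
    go (_ ∷ _ ∷ _) (s≤s ()) _ _ _

horn-preservedBy-and₃ : ∀ (φ : HornFm) → PreservedBy and₃ (hornFm φ)
horn-preservedBy-and₃ (cs , horn) =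
  clausal-preservedBy and₃ cs (All.map (λ {c} → horn-clause-preservedBy-and₃ c) horn)

maj : Op₃
maj a b c = (a ∧ᵇ b) ∨ᵇ (b ∧ᵇ c) ∨ᵇ (a ∧ᵇ c)

maj-selfDual : ∀ a b c → not (maj a b c) ≡ maj (not a) (not b) (not c)
maj-selfDual true  true  true  = ≡.refl
maj-selfDual true  true  false = ≡.refl
maj-selfDual true  false true  = ≡.refl
maj-selfDual true  false false = ≡.refl
maj-selfDual false true  true  = ≡.refl
maj-selfDual false true  false = ≡.refl
maj-selfDual false false true  = ≡.refl
maj-selfDual false false false = ≡.refl

maj-₁₂ : ∀ {a b c} → T a → T b → T (maj a b c)
maj-₁₂ {true} {true} _ _ = tt

maj-₂₃ : ∀ {a b c} → T b → T c → T (maj a b c)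
maj-₂₃ {true}  {true} {true} _ _ = tt
maj-₂₃ {false} {true} {true} _ _ = tt

maj-₁₃ : ∀ {a b c} → T a → T c → T (maj a b c)
maj-₁₃ {true} {true}  {true} _ _ = tt
maj-₁₃ {true} {false} {true} _ _ = tt

maj-pigeonhole : ∀ {a₁ a₂ a₃ b₁ b₂ b₃} → T a₁ ⊎ T b₁ → T a₂ ⊎ T b₂ → T a₃ ⊎ T b₃ →
  T (maj a₁ a₂ a₃) ⊎ T (maj b₁ b₂ b₃)
maj-pigeonhole         (inj₁ x) (inj₁ y) _        = inj₁ (maj-₁₂ x y)
maj-pigeonhole         (inj₂ x) (inj₂ y) _        = inj₂ (maj-₁₂ x y)
maj-pigeonhole         (inj₁ x) _        (inj₁ z) = inj₁ (maj-₁₃ x z)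
maj-pigeonhole         (inj₂ x) _        (inj₂ z) = inj₂ (maj-₁₃ x z)
maj-pigeonhole {a₁}    _        (inj₁ y) (inj₁ z) = inj₁ (maj-₂₃ {a₁} y z)
maj-pigeonhole {b₁ = b₁} _      (inj₂ y) (inj₂ z) = inj₂ (maj-₂₃ {b₁} y z)

neg-commutesWith-maj : ∀ {φ} → CommutesWith maj φ → CommutesWith maj (neg φ)
neg-commutesWith-maj {φ} commutes V₁ V₂ V₃ =
  ≡.trans (cong not (commutes V₁ V₂ V₃)) (maj-selfDual (eval V₁ φ) (eval V₂ φ) (eval V₃ φ))

⋁-preservedBy-maj : ∀ {φs} → All (CommutesWith maj) φs → length φs ≤ 2 → PreservedBy maj (⋁ φs)
⋁-preservedBy-maj []            _ _ _ _ ()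
⋁-preservedBy-maj (cφ ∷ [])     _ V₁ V₂ V₃ t₁ t₂ _ =
  subst T (≡.sym (cφ V₁ V₂ V₃)) (maj-₁₂ t₁ t₂)
⋁-preservedBy-maj {φ ∷ ψ ∷ []} (cφ ∷ cψ ∷ []) _ V₁ V₂ V₃ t₁ t₂ t₃
  rewrite cφ V₁ V₂ V₃ | cψ V₁ V₂ V₃ =
  from T-∨ (maj-pigeonhole (to (T-∨ {eval V₁ φ}) t₁) (to (T-∨ {eval V₂ φ}) t₂)
                           (to (T-∨ {eval V₃ φ}) t₃))
⋁-preservedBy-maj (_ ∷ _ ∷ _ ∷ _) (s≤s (s≤s ()))

krom-clause-preservedBy-maj : ∀ c → IsKromClause c → PreservedBy maj (clauseFm c)
krom-clause-preservedBy-maj c@(clause _ ns ps) krom =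
  clause-preservedBy maj c (⋁-preservedBy-maj (All.++⁺ negCommute posCommute) short)
  where
  posCommute : All (CommutesWith maj) (map litFm ps)
  posCommute = All.map⁺ (universal (literal-commutesWith maj ≡.refl) ps)
  negCommute : All (CommutesWith maj) (map (neg ∘ litFm) ns)
  negCommute = All.map⁺
    (universal (λ l → neg-commutesWith-maj {litFm l} (literal-commutesWith maj ≡.refl l)) ns)
  short : length (map (neg ∘ litFm) ns ++ map litFm ps) ≤ 2
  short = subst (_≤ 2)
    (≡.sym (≡.trans (length-++ (map (neg ∘ litFm) ns))
                    (cong₂ _+_ (length-map (neg ∘ litFm) ns) (length-map litFm ps))))
    krom

krom-preservedBy-maj : ∀ (φ : KromFm) → PreservedBy maj (kromFm φ)
krom-preservedBy-maj (cs , krom) =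
  clausal-preservedBy maj cs (All.map (λ {c} → krom-clause-preservedBy-maj c) krom)

valuationOf : List Letter → Valuation
valuationOf ps p = any (_≡ᵇ p) ps

p₀∧p₁→p₂ : HornFm
p₀∧p₁→p₂ = (clause 0 (pvar 0 ∷ pvar 1 ∷ []) (pvar 2 ∷ []) ∷ []) , (s≤s z≤n ∷ [])

p₀∨p₁ : KromFm
p₀∨p₁ = (clause 0 [] (pvar 0 ∷ pvar 1 ∷ []) ∷ []) , (s≤s (s≤s z≤n) ∷ [])

p₀∧p₁→p₂-not-preservedBy-maj : ¬ PreservedBy maj (hornFm p₀∧p₁→p₂)
p₀∧p₁→p₂-not-preservedBy-maj preserved =
  preserved (valuationOf (0 ∷ [])) (valuationOf (1 ∷ [])) (valuationOf (0 ∷ 1 ∷ 2 ∷ [])) tt tt tt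

p₀∨p₁-not-preservedBy-and₃ : ¬ PreservedBy and₃ (kromFm p₀∨p₁)
p₀∨p₁-not-preservedBy-and₃ preserved =
  preserved (valuationOf (0 ∷ [])) (valuationOf (1 ∷ [])) (valuationOf (1 ∷ [])) tt tt tt

corollary3p4 : (L : Logic) → ¬ HornToKrom L × ¬ KromToHorn L
corollary3p4 L = no-horn→krom , no-krom→horn
  where
  no-horn→krom : ¬ HornToKrom L
  no-horn→krom (t , preserving) = p₀∧p₁→p₂-not-preservedBy-maj
    (preservedBy-reflect maj hornFm kromFm t preserving p₀∧p₁→p₂ (krom-preservedBy-maj (t p₀∧p₁→p₂)))

  no-krom→horn : ¬ KromToHorn L
  no-krom→horn (t , preserving) = p₀∨p₁-not-preservedBy-and₃
    (preservedBy-reflect and₃ kromFm hornFm t preserving p₀∨p₁ (horn-preservedBy-and₃ (t p₀∨p₁)))
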